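{- Let $T_1$ be the tree with vertex set $\{1,2,3,4,5,6,7,8\}$ and edge set $\{12,23,34,45,26,37,48\}$. Then $P_4\square T_1$ is $1$-tough but not Hamiltonian.
   Context: All graphs are finite and simple. $P_4$ is the path with $4$ vertices. The Cartesian product $G_1\square G_2$ has vertex set $\{v_u : v\in V(G_1), u\in V(G_2)\}$, with $v_u v_w$ an edge whenever $uw\in E(G_2)$, and $v_u w_u$ an edge whenever $vw\in E(G_1)$. A graph is Hamiltonian if it has a spanning cycle. For $S\subseteq V(G)$, $c(G-S)$ is the number of components of the subgraph induced on $V(G)\setminus S$; $G$ is $1$-tough if $|S|\geq c(G-S)$ for every $S\subseteq V(G)$ with $c(G-S)\geq 2$. -}

module Defs where

open import Data.Nat using (ℕ; _≤_)
open import Data.Fin using (Fin; #_)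
open import Data.Product using (Σ; _×_; _,_; proj₁)
open import Data.Sum using (_⊎_)
open import Data.List using (List; []; _∷_; _++_; [_]; length)
open import Data.List.Membership.Propositional using (_∈_)
open import Data.List.Relation.Unary.Unique.Propositional using (Unique)
open import Data.List.Relation.Unary.Linked using (Linked)
open import Relation.Nullary using (¬_)
open import Relation.Binary.PropositionalEquality using (_≡_)
open import Function.Bundles using (_⇔_)

record Graph : Set₁ where
  field
    V   : Set
    Adj : V → V → Set
open Graph public

fromEdges : (n : ℕ) → List (Fin n × Fin n) → Graph
fromEdges n E = record { V = Fin n ; Adj = λ u v → ((u , v) ∈ E) ⊎ ((v , u) ∈ E) }

P₄ : Graph
P₄ = fromEdges 4 ((# 0 , # 1) ∷ (# 1 , # 2) ∷ (# 2 , # 3) ∷ [])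

-- T₁ : vertex i : Fin 8 stands for paper vertex i+1.
-- Paper edges 12,23,34,45,26,37,48.
T₁ : Graph
T₁ = fromEdges 8 ((# 0 , # 1) ∷ (# 1 , # 2) ∷ (# 2 , # 3) ∷ (# 3 , # 4) ∷ (# 1 , # 5) ∷ (# 2 , # 6) ∷ (# 3 , # 7) ∷ [])

-- Cartesian product: vertex (v , u) is v_u with v ∈ V(G₁), u ∈ V(G₂).
_□_ : Graph → Graph → Graph
G₁ □ G₂ = record
  { V   = V G₁ × V G₂
  ; Adj = λ { (v , u) (w , x) → (v ≡ w × Adj G₂ u x) ⊎ (u ≡ x × Adj G₁ v w) } }

Hamiltonian : Graph → Set
Hamiltonian G = Σ (V G) λ v → Σ (List (V G)) λ vs →
  Unique (v ∷ vs) × (3 ≤ length (v ∷ vs)) ×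
  ((w : V G) → w ∈ (v ∷ vs)) ×
  Linked (Adj G) (v ∷ vs ++ [ v ])

-- Reachability inside the subgraph induced on V(G) ∖ S
-- (the starting vertex is assumed outside S by the caller).
data Reach (G : Graph) (S : List (V G)) : V G → V G → Set where
  here : ∀ {u} → Reach G S u u
  step : ∀ {u v w} → Adj G u v → ¬ (v ∈ S) → Reach G S v w → Reach G S u w

Outside : (G : Graph) → List (V G) → Set
Outside G S = Σ (V G) λ v → ¬ (v ∈ S)

-- c(G - S) = k : the components of G - S are in bijection with Fin k,
-- i.e. there is a surjective labelling by Fin k whose fibres are exactly
-- the connectivity classes of G - S.
NumComponents : (G : Graph) → List (V G) → ℕ → Set
NumComponents G S k = Σ (Outside G S → Fin k) λ f →
  ((i : Fin k) → Σ (Outside G S) λ x → f x ≡ i) ×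
  ((x y : Outside G S) → (f x ≡ f y) ⇔ Reach G S (proj₁ x) (proj₁ y))

OneTough : Graph → Set
OneTough G = (S : List (V G)) → Unique S → (k : ℕ) →
  NumComponents G S k → 2 ≤ k → k ≤ length S

module Submission where

open import Defs
open import Data.Product using (_×_)
open import Relation.Nullary using (¬_)

open import Data.Bool using (Bool; true; false; not; if_then_else_)
import Data.Bool.Properties as Bool
open import Data.Bool.Properties using (¬-not; not-injective)
open import Data.Empty using (⊥; ⊥-elim)
open import Data.Fin using (Fin; #_)
import Data.Fin as Fin
open import Data.Fin.Properties using (all?; injective⇒≤)
open import Data.List using (List; []; _∷_; _++_; [_]; length; iterate; reverse)
import Data.List.Membership.DecPropositional
open import Data.List.Membership.Propositional using (_∈_; _∉_)
open import Data.List.Membership.Setoid.Properties using (index-injective)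
open import Data.List.Relation.Unary.All as All using (All; []; _∷_)
open import Data.List.Relation.Unary.AllPairs using (_∷_)
open import Data.List.Relation.Unary.Any using (here; there; index)
open import Data.List.Relation.Unary.Linked using (Linked; [-]; _∷_)
open import Data.List.Relation.Unary.Unique.Propositional using (Unique)
open import Data.Nat using (ℕ; zero; suc; _≤_; s≤s)
open import Data.Product using (Σ; _,_; proj₁; proj₂; map₂)
open import Data.Product.Properties using (≡-dec)
open import Data.Sum as Sum using (_⊎_; inj₁; inj₂)
open import Function.Bundles using (Equivalence; _⇔_)
open import Relation.Binary.Definitions using (Symmetric; DecidableEquality)
open import Relation.Binary.PropositionalEquality using (_≡_; _≢_; refl; sym; trans; cong; subst; setoid)
open import Relation.Nullary using (Dec; yes; no)
open import Relation.Nullary.Decidable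
  using (⌊_⌋; map′; _⊎-dec_; _×-dec_; _→-dec_; ¬?; decidable-stable; from-yes)

-- A Hamiltonian cycle is read through its successor map σ,
-- a permutation along edges of G with a single orbit of size ≥ 3 (module
-- HamiltonianCycle).  Consequently every vertex lies on exactly two cycle edges,
-- a vertex with only two candidate cycle neighbours uses both (forced), and the
-- cycle crosses every vertex partition along two different edges
-- (crosses-twice).  For a pendant pair -- leaves e, l at m, whose only other
-- neighbour is c -- this shows that a Hamiltonian cycle of P₄ □ T avoids the rung
-- (0 , m)(0 , c) and uses (1 , m)(1 , c) (module PendantPair).  T₁ has pendant
-- pairs at # 1 and at # 3, both towards # 2; with the corner (0 , 2) this puts
-- three cycle edges at (1 , 2).
--
-- A graph with a spanning two-cycle factor whose cycles are linked
-- as in TwoCycleFactor is 1-tough: for every S, the components of G - S are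
-- charged injectively to vertices of S.  P₄ □ T₁ has such a factor, whose
-- properties are checked by evaluation.

-- Succ z L x y : y follows x on the walk L ++ [ z ].  A Hamiltonian cycle
-- v ∷ vs is the closed walk (v ∷ vs) ++ [ v ], and Succ v (v ∷ vs) is its
-- successor relation.
module _ {A : Set} where

  data Succ (z : A) : List A → A → A → Set where
    last  : ∀ {x} → Succ z [ x ] x z
    first : ∀ {x y L} → Succ z (x ∷ y ∷ L) x y
    later : ∀ {a L x y} → Succ z L x y → Succ z (a ∷ L) x y

  succ-linked : ∀ {R : A → A → Set} {z x y} L → Linked R (L ++ [ z ]) → Succ z L x y → R x y
  succ-linked (a ∷ []) (r ∷ [-]) last = r
  succ-linked (a ∷ b ∷ L) (r ∷ _) first = r
  succ-linked (a ∷ b ∷ L) (_ ∷ rs) (later s) = succ-linked (b ∷ L) rs s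

  succ-source : ∀ {z x y L} → Succ z L x y → x ∈ L
  succ-source last = here refl
  succ-source first = here refl
  succ-source (later s) = there (succ-source s)

  succ-target : ∀ {z x y a L} → Succ z (a ∷ L) x y → y ∈ L ⊎ y ≡ z
  succ-target last = inj₂ refl
  succ-target first = inj₁ (here refl)
  succ-target {L = b ∷ L} (later s) with succ-target s
  ... | inj₁ y∈L = inj₁ (there y∈L)
  ... | inj₂ y≡z = inj₂ y≡z

  succ-exists : ∀ {z x} L → x ∈ L → Σ A (Succ z L x)
  succ-exists (a ∷ []) (here refl) = _ , last
  succ-exists (a ∷ b ∷ L) (here refl) = b , first
  succ-exists (a ∷ L) (there x∈L) = map₂ later (succ-exists L x∈L)

  pred-exists : ∀ {z y} a L → y ∈ L ⊎ y ≡ z → Σ A λ x → Succ z (a ∷ L) x y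
  pred-exists a [] (inj₂ refl) = a , last
  pred-exists a (b ∷ L) (inj₁ (here refl)) = a , first
  pred-exists a (b ∷ L) (inj₁ (there y∈L)) = map₂ later (pred-exists b L (inj₁ y∈L))
  pred-exists a (b ∷ L) (inj₂ y≡z) = map₂ later (pred-exists b L (inj₂ y≡z))

  no-return : ∀ {z x b L} → All (b ≢_) L → z ∉ b ∷ L → ¬ Succ z (b ∷ L) x b
  no-return b∉L z∉ s with succ-target s
  ... | inj₁ b∈L = All.lookup b∉L b∈L refl
  ... | inj₂ refl = z∉ (here refl)

  succ-unique : ∀ {z x y y'} L → Unique L → Succ z L x y → Succ z L x y' → y ≡ y'
  succ-unique (a ∷ []) _ last last = refl
  succ-unique (a ∷ b ∷ L) _ first first = refl
  succ-unique (a ∷ b ∷ L) (a∉ ∷ _) first (later s) = ⊥-elim (All.lookup a∉ (succ-source s) refl)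
  succ-unique (a ∷ b ∷ L) (a∉ ∷ _) (later s) first = ⊥-elim (All.lookup a∉ (succ-source s) refl)
  succ-unique (a ∷ b ∷ L) (_ ∷ u) (later s) (later s') = succ-unique (b ∷ L) u s s'

  pred-unique : ∀ {z x x' y} a L → Unique L → z ∉ L → Succ z (a ∷ L) x y → Succ z (a ∷ L) x' y → x ≡ x'
  pred-unique a [] _ _ last last = refl
  pred-unique a (b ∷ L) _ _ first first = refl
  pred-unique a (b ∷ L) (b∉ ∷ _) z∉ first (later s) = ⊥-elim (no-return b∉ z∉ s)
  pred-unique a (b ∷ L) (b∉ ∷ _) z∉ (later s) first = ⊥-elim (no-return b∉ z∉ s)
  pred-unique a (b ∷ L) (_ ∷ u) z∉ (later s) (later s') = pred-unique b L u (λ z∈ → z∉ (there z∈)) s s'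

  reaches-end : ∀ {P : A → Set} {z x} L → (∀ {u w} → Succ z L u w → P u → P w) → x ∈ L → P x → P z
  reaches-end (a ∷ []) preserve (here refl) p = preserve last p
  reaches-end (a ∷ b ∷ L) preserve (here refl) p = reaches-end (b ∷ L) (λ s → preserve (later s)) (here refl) (preserve first p)
  reaches-end (a ∷ L) preserve (there x∈L) p = reaches-end L (λ s → preserve (later s)) x∈L p

  spreads : ∀ {P : A → Set} {z} a L → (∀ {u w} → Succ z (a ∷ L) u w → P u → P w) → P a → All P (a ∷ L)
  spreads a [] preserve p = p ∷ []
  spreads a (b ∷ L) preserve p = p ∷ spreads b L (λ s → preserve (later s)) (preserve first p)

  pigeonhole : ∀ {a b x y w : A} → x ≡ a ⊎ x ≡ b → y ≡ a ⊎ y ≡ b → w ≡ a ⊎ w ≡ b →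
               x ≢ y → x ≢ w → y ≢ w → ⊥
  pigeonhole (inj₁ refl) (inj₁ refl) _ x≢y _ _ = x≢y refl
  pigeonhole (inj₂ refl) (inj₂ refl) _ x≢y _ _ = x≢y refl
  pigeonhole (inj₁ refl) _ (inj₁ refl) _ x≢w _ = x≢w refl
  pigeonhole (inj₂ refl) _ (inj₂ refl) _ x≢w _ = x≢w refl
  pigeonhole _ (inj₁ refl) (inj₁ refl) _ _ y≢w = y≢w refl
  pigeonhole _ (inj₂ refl) (inj₂ refl) _ _ y≢w = y≢w refl

module HamiltonianCycle (G : Graph) {v : V G} {vs : List (V G)} (distinct : Unique (v ∷ vs))
                        (long : 3 ≤ length (v ∷ vs)) (spanning : ∀ w → w ∈ v ∷ vs)
                        (closed : Linked (Adj G) (v ∷ vs ++ [ v ])) where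

  Next : V G → V G → Set
  Next = Succ v (v ∷ vs)

  σ : V G → V G
  σ x = proj₁ (succ-exists {z = v} (v ∷ vs) (spanning x))

  σ-next : ∀ x → Next x (σ x)
  σ-next x = proj₂ (succ-exists {z = v} (v ∷ vs) (spanning x))

  next⇒σ : ∀ {x y} → Next x y → σ x ≡ y
  next⇒σ {x} = succ-unique (v ∷ vs) distinct (σ-next x)

  σ-adj : ∀ x → Adj G x (σ x)
  σ-adj x = succ-linked (v ∷ vs) closed (σ-next x)

  σ-injective : ∀ {x y} → σ x ≡ σ y → x ≡ y
  σ-injective {x} {y} eq = injective distinct
    where
    injective : Unique (v ∷ vs) → x ≡ y
    injective (v∉vs ∷ distinct-vs) =
      pred-unique v vs distinct-vs (λ v∈vs → All.lookup v∉vs v∈vs refl)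
                  (σ-next x) (subst (Next y) (sym eq) (σ-next y))

  σ-surjective : ∀ y → Σ (V G) λ x → σ x ≡ y
  σ-surjective y with spanning y
  ... | here refl = map₂ next⇒σ (pred-exists v vs (inj₂ refl))
  ... | there y∈vs = map₂ next⇒σ (pred-exists v vs (inj₁ y∈vs))

  σ-invariant : (P : V G → Set) → (∀ x → P x → P (σ x)) → ∀ {x} → P x → ∀ w → P w
  σ-invariant P inv {x} p w =
    All.lookup (spreads v vs preserved (reaches-end (v ∷ vs) preserved (spanning x) p)) (spanning w)
    where
    preserved : ∀ {u w} → Next u w → P u → P w
    preserved {u} s pu = subst P (next⇒σ s) (inv u pu)

  no-2-cycle : ∀ {a} → σ (σ a) ≡ a → ⊥
  no-2-cycle {a} back = three-vertices distinct long
    where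
    in-orbit : ∀ w → w ≡ a ⊎ w ≡ σ a
    in-orbit = σ-invariant (λ w → w ≡ a ⊎ w ≡ σ a) flip (inj₁ refl)
      where
      flip : ∀ x → x ≡ a ⊎ x ≡ σ a → σ x ≡ a ⊎ σ x ≡ σ a
      flip x (inj₁ refl) = inj₂ refl
      flip x (inj₂ refl) = inj₁ back
    three-vertices : ∀ {L} → Unique L → 3 ≤ length L → ⊥
    three-vertices {x ∷ y ∷ w ∷ _} ((x≢y ∷ x≢w ∷ _) ∷ (y≢w ∷ _) ∷ _) _ =
      pigeonhole (in-orbit x) (in-orbit y) (in-orbit w) x≢y x≢w y≢w
    three-vertices {_ ∷ []} _ (s≤s ())
    three-vertices {_ ∷ _ ∷ []} _ (s≤s (s≤s ()))

  Edge : V G → V G → Set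
  Edge x y = σ x ≡ y ⊎ σ y ≡ x

  edge-sym : ∀ {x y} → Edge x y → Edge y x
  edge-sym = Sum.swap

  edge-adj : Symmetric (Adj G) → ∀ {x y} → Edge x y → Adj G x y
  edge-adj sym-adj (inj₁ refl) = σ-adj _
  edge-adj sym-adj (inj₂ refl) = sym-adj (σ-adj _)

  edge? : DecidableEquality (V G) → ∀ x y → Dec (Edge x y)
  edge? _≟_ x y = (σ x ≟ y) ⊎-dec (σ y ≟ x)

  -- Every vertex lies on exactly two cycle edges: to σ x and to its σ-preimage.
  at-most-two : ∀ {x a b c} → Edge x a → Edge x b → Edge x c → a ≢ b → a ≢ c → b ≢ c → ⊥
  at-most-two {x} ea eb ec = pigeonhole (kind ea) (kind eb) (kind ec)
    where
    p : V G
    p = proj₁ (σ-surjective x)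
    kind : ∀ {y} → Edge x y → y ≡ σ x ⊎ y ≡ p
    kind (inj₁ refl) = inj₁ refl
    kind (inj₂ σy≡x) = inj₂ (σ-injective (trans σy≡x (sym (proj₂ (σ-surjective x)))))

  -- The two cycle edges at x are distinct since σ has no 2-cycle.
  at-least-two : ∀ x → Σ (V G) λ p → Edge x (σ x) × Edge x p × σ x ≢ p
  at-least-two x with σ-surjective x
  ... | p , σp≡x = p , inj₁ refl , inj₂ σp≡x , λ σx≡p → no-2-cycle (trans (cong σ σx≡p) σp≡x)

  forced : ∀ {x p q} → (∀ y → Edge x y → y ≡ p ⊎ y ≡ q) → Edge x p × Edge x q
  forced {x} only with at-least-two x
  ... | p' , e₁ , e₂ , σx≢p' with only _ e₁ | only _ e₂
  ... | inj₁ refl | inj₂ refl = e₁ , e₂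
  ... | inj₂ refl | inj₁ refl = e₂ , e₁
  ... | inj₁ refl | inj₁ refl = ⊥-elim (σx≢p' refl)
  ... | inj₂ refl | inj₂ refl = ⊥-elim (σx≢p' refl)

  stays : (P : V G → Set) → (∀ x → Dec (P x)) → ∀ {a} → (∀ x → P x → ¬ P (σ x) → x ≡ a) →
          (P a → P (σ a)) → ∀ x → P x → P (σ x)
  stays P P? only-at-a kept-at-a x px with P? (σ x)
  ... | yes pσx = pσx
  ... | no ¬pσx with only-at-a x px ¬pσx
  ...   | refl = kept-at-a px

  leaves-at : (P : V G → Set) → (∀ x → Dec (P x)) → ∀ {u w a} → P u → ¬ P w →
              (∀ x → P x → ¬ P (σ x) → x ≡ a) → P a × ¬ P (σ a)
  leaves-at P P? {u} {w} {a} pu ¬pw only-at-a with P? a | P? (σ a)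
  ... | yes pa | no ¬pσa = pa , ¬pσa
  ... | yes pa | yes pσa = ⊥-elim (¬pw (σ-invariant P (stays P P? only-at-a (λ _ → pσa)) pu w))
  ... | no ¬pa | _ = ⊥-elim (¬pw (σ-invariant P (stays P P? only-at-a (λ pa → ⊥-elim (¬pa pa))) pu w))

  crosses-twice : (P : V G → Set) → (∀ x → Dec (P x)) → ∀ {u w} → P u → ¬ P w → ∀ {a b} →
                  (∀ x y → P x → ¬ P y → Edge x y → x ≡ a × y ≡ b) → ⊥
  crosses-twice P P? {u} {w} pu ¬pw {a} {b} only-ab = no-2-cycle (trans (cong σ σa≡b) σb≡a)
    where
    out : P a × ¬ P (σ a)
    out = leaves-at P P? pu ¬pw (λ x px ¬pσx → proj₁ (only-ab x (σ x) px ¬pσx (inj₁ refl)))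
    σa≡b : σ a ≡ b
    σa≡b = proj₂ (only-ab a (σ a) (proj₁ out) (proj₂ out) (inj₁ refl))
    back : ¬ P b × ¬ ¬ P (σ b)
    back = leaves-at (λ x → ¬ P x) (λ x → ¬? (P? x)) ¬pw (λ ¬pu → ¬pu pu)
             (λ x ¬px ¬¬pσx → proj₂ (only-ab (σ x) x (decidable-stable (P? (σ x)) ¬¬pσx) ¬px (inj₂ refl)))
    σb≡a : σ b ≡ a
    σb≡a = proj₁ (only-ab (σ b) b (decidable-stable (P? (σ b)) (proj₂ back)) (proj₁ back) (inj₂ refl))

fromEdges-sym : ∀ n E → Symmetric (Adj (fromEdges n E))
fromEdges-sym n E = Sum.swap

fromEdges-adj? : ∀ n E x y → Dec (Adj (fromEdges n E) x y)
fromEdges-adj? n E x y = ((x , y) ∈? E) ⊎-dec ((y , x) ∈? E)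
  where open Data.List.Membership.DecPropositional (≡-dec Fin._≟_ Fin._≟_)

□-sym : ∀ {G₁ G₂} → Symmetric (Adj G₁) → Symmetric (Adj G₂) → Symmetric (Adj (G₁ □ G₂))
□-sym sym₁ sym₂ (inj₁ (refl , a)) = inj₁ (refl , sym₂ a)
□-sym sym₁ sym₂ (inj₂ (refl , a)) = inj₂ (refl , sym₁ a)

□-adj? : ∀ {G₁ G₂} → DecidableEquality (V G₁) → DecidableEquality (V G₂) →
         (∀ x y → Dec (Adj G₁ x y)) → (∀ x y → Dec (Adj G₂ x y)) → ∀ x y → Dec (Adj (G₁ □ G₂) x y)
□-adj? _≟₁_ _≟₂_ adj₁? adj₂? (v , u) (w , x) = ((v ≟₁ w) ×-dec adj₂? u x) ⊎-dec ((u ≟₂ x) ×-dec adj₁? v w)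

P₄-adj? : ∀ i j → Dec (Adj P₄ i j)
P₄-adj? = fromEdges-adj? 4 _

P₄-end₀ : ∀ j → Adj P₄ (# 0) j → j ≡ # 1
P₄-end₀ = from-yes (all? λ j → P₄-adj? (# 0) j →-dec (j Fin.≟ # 1))

P₄-end₃ : ∀ j → Adj P₄ (# 3) j → j ≡ # 2
P₄-end₃ = from-yes (all? λ j → P₄-adj? (# 3) j →-dec (j Fin.≟ # 2))

-- In P₄ □ T the twelve vertices of the
-- columns e, m, l are joined to the rest only by the rungs (i , m)(i , c).
-- A Hamiltonian cycle must enter the corners (0 , e), (0 , l) from (0 , m),
-- so it avoids the rung in row 0 (and likewise row 3); as it crosses into the
-- block twice, it uses the rungs in rows 1 and 2.
module PendantPair (T : Graph) (_≟_ : DecidableEquality (V T)) (T-sym : Symmetric (Adj T))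
                   {e m l c : V T}
                   (e-leaf : ∀ u → Adj T e u → u ≡ m) (l-leaf : ∀ u → Adj T l u → u ≡ m)
                   (m-nbrs : ∀ u → Adj T m u → u ≡ e ⊎ u ≡ l ⊎ u ≡ c)
                   (e≢l : e ≢ l) (c≢e : c ≢ e) (c≢m : c ≢ m) (c≢l : c ≢ l)
                   {v : Fin 4 × V T} {vs : List (Fin 4 × V T)} (distinct : Unique (v ∷ vs))
                   (long : 3 ≤ length (v ∷ vs)) (spanning : ∀ w → w ∈ v ∷ vs)
                   (closed : Linked (Adj (P₄ □ T)) (v ∷ vs ++ [ v ])) where

  open HamiltonianCycle (P₄ □ T) distinct long spanning closed

  G-sym : Symmetric (Adj (P₄ □ T))
  G-sym = □-sym {P₄} {T} (fromEdges-sym 4 _) T-sym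

  corner : ∀ {i i' t} → (∀ j → Adj P₄ i j → j ≡ i') → (∀ u → Adj T t u → u ≡ m) → Edge (i , t) (i , m)
  corner {i} {i'} {t} end leaf = proj₁ (forced only)
    where
    only : ∀ y → Edge (i , t) y → y ≡ (i , m) ⊎ y ≡ (i' , t)
    only (j , u) edge with edge-adj G-sym edge
    ... | inj₁ (refl , tu) = inj₁ (cong (i ,_) (leaf u tu))
    ... | inj₂ (refl , ij) = inj₂ (cong (_, t) (end j ij))

  -- In an end row both cycle edges at (i , m) go to the corners.
  no-end-rung : ∀ {i i'} → (∀ j → Adj P₄ i j → j ≡ i') → ¬ Edge (i , m) (i , c)
  no-end-rung end rung =
    at-most-two (edge-sym (corner end e-leaf)) (edge-sym (corner end l-leaf)) rung
                (λ eq → e≢l (cong proj₂ eq)) (λ eq → c≢e (sym (cong proj₂ eq)))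
                (λ eq → c≢l (sym (cong proj₂ eq)))

  _≟G_ : DecidableEquality (Fin 4 × V T)
  _≟G_ = ≡-dec Fin._≟_ _≟_

  InBlock : Fin 4 × V T → Set
  InBlock (_ , t) = t ≡ e ⊎ t ≡ m ⊎ t ≡ l

  inBlock? : ∀ x → Dec (InBlock x)
  inBlock? (_ , t) = (t ≟ e) ⊎-dec (t ≟ m) ⊎-dec (t ≟ l)

  c∉block : ∀ {i} → ¬ InBlock (i , c)
  c∉block (inj₁ c≡e) = c≢e c≡e
  c∉block (inj₂ (inj₁ c≡m)) = c≢m c≡m
  c∉block (inj₂ (inj₂ c≡l)) = c≢l c≡l

  leaving : ∀ x y → InBlock x → ¬ InBlock y → Adj (P₄ □ T) x y → Σ (Fin 4) λ i → x ≡ (i , m) × y ≡ (i , c)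
  leaving x y x∈ y∉ (inj₂ (refl , _)) = ⊥-elim (y∉ x∈)
  leaving x (_ , u) (inj₁ refl) y∉ (inj₁ (refl , tu)) = ⊥-elim (y∉ (inj₂ (inj₁ (e-leaf u tu))))
  leaving x (_ , u) (inj₂ (inj₂ refl)) y∉ (inj₁ (refl , tu)) = ⊥-elim (y∉ (inj₂ (inj₁ (l-leaf u tu))))
  leaving (i , _) (_ , u) (inj₂ (inj₁ refl)) y∉ (inj₁ (refl , tu)) with m-nbrs u tu
  ... | inj₁ u≡e = ⊥-elim (y∉ (inj₁ u≡e))
  ... | inj₂ (inj₁ u≡l) = ⊥-elim (y∉ (inj₂ (inj₂ u≡l)))
  ... | inj₂ (inj₂ refl) = i , refl , refl

  top-rung-unused : ¬ Edge (# 0 , m) (# 0 , c)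
  top-rung-unused = no-end-rung P₄-end₀

  uses-rung : Edge (# 1 , m) (# 1 , c)
  uses-rung with edge? _≟G_ (# 1 , m) (# 1 , c)
  ... | yes rung = rung
  ... | no ¬rung = ⊥-elim (crosses-twice InBlock inBlock? {u = # 0 , m} {w = # 0 , c}
                                         (inj₂ (inj₁ refl)) (c∉block {# 0}) only-row-2)
    where
    -- without the rung in row 1, the block would be left only along row 2
    row-2 : ∀ i → Edge (i , m) (i , c) → (i , m) ≡ (# 2 , m) × (i , c) ≡ (# 2 , c)
    row-2 Fin.zero rung = ⊥-elim (top-rung-unused rung)
    row-2 (Fin.suc Fin.zero) rung = ⊥-elim (¬rung rung)
    row-2 (Fin.suc (Fin.suc Fin.zero)) rung = refl , refl
    row-2 (Fin.suc (Fin.suc (Fin.suc Fin.zero))) rung = ⊥-elim (no-end-rung P₄-end₃ rung)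
    only-row-2 : ∀ x y → InBlock x → ¬ InBlock y → Edge x y → x ≡ (# 2 , m) × y ≡ (# 2 , c)
    only-row-2 x y x∈ y∉ edge with leaving x y x∈ y∉ (edge-adj G-sym edge)
    ... | i , refl , refl = row-2 i edge

T₁-adj? : ∀ t u → Dec (Adj T₁ t u)
T₁-adj? = fromEdges-adj? 8 _

leaf? : (t u : Fin 8) → Dec (∀ w → Adj T₁ t w → w ≡ u)
leaf? t u = all? λ w → T₁-adj? t w →-dec (w Fin.≟ u)

nbrs₃? : (t u₁ u₂ u₃ : Fin 8) → Dec (∀ w → Adj T₁ t w → w ≡ u₁ ⊎ w ≡ u₂ ⊎ w ≡ u₃)
nbrs₃? t u₁ u₂ u₃ = all? λ w → T₁-adj? t w →-dec ((w Fin.≟ u₁) ⊎-dec (w Fin.≟ u₂) ⊎-dec (w Fin.≟ u₃))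

-- By the pendant pairs at # 1 and at # 3, a
-- Hamiltonian cycle uses the rungs (1 , 1)(1 , 2) and (1 , 3)(1 , 2) but not
-- (0 , 1)(0 , 2) and (0 , 3)(0 , 2).  So (0 , 2) can only use (0 , 6) and
-- (1 , 2), which gives (1 , 2) a third cycle edge.
not-Hamiltonian : ¬ Hamiltonian (P₄ □ T₁)
not-Hamiltonian (v , vs , distinct , long , spanning , closed) =
  at-most-two (edge-sym Left.uses-rung) (edge-sym Right.uses-rung) down (λ ()) (λ ()) (λ ())
  where
  open HamiltonianCycle (P₄ □ T₁) distinct long spanning closed
  module Left = PendantPair T₁ Fin._≟_ (fromEdges-sym 8 _) (from-yes (leaf? (# 0) (# 1))) (from-yes (leaf? (# 5) (# 1)))
                  (from-yes (nbrs₃? (# 1) (# 0) (# 5) (# 2))) (λ ()) (λ ()) (λ ()) (λ ()) distinct long spanning closed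
  module Right = PendantPair T₁ Fin._≟_ (fromEdges-sym 8 _) (from-yes (leaf? (# 4) (# 3))) (from-yes (leaf? (# 7) (# 3)))
                  (from-yes (nbrs₃? (# 3) (# 4) (# 7) (# 2))) (λ ()) (λ ()) (λ ()) (λ ()) distinct long spanning closed
  only : ∀ y → Edge (# 0 , # 2) y → y ≡ (# 0 , # 6) ⊎ y ≡ (# 1 , # 2)
  only (j , u) edge with edge-adj (□-sym {P₄} {T₁} (fromEdges-sym 4 _) (fromEdges-sym 8 _)) edge
  ... | inj₂ (refl , ij) = inj₂ (cong (_, # 2) (P₄-end₀ j ij))
  ... | inj₁ (refl , tu) with from-yes (nbrs₃? (# 2) (# 1) (# 3) (# 6)) u tu
  ...   | inj₁ refl = ⊥-elim (Left.top-rung-unused (edge-sym edge))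
  ...   | inj₂ (inj₁ refl) = ⊥-elim (Right.top-rung-unused (edge-sym edge))
  ...   | inj₂ (inj₂ refl) = inj₁ refl
  down : Edge (# 1 , # 2) (# 0 , # 2)
  down = edge-sym (proj₂ (forced only))

-- Two-cycle factors.  σ is a permutation of V(G) moving every vertex to a
-- neighbour, with two orbits told apart by `side`; every vertex reaches, and is
-- reached from, the base vertex of its orbit within `bound` steps.  For each
-- side c, some σ-edge (hub⁻ c , hub c) of the other orbit has both ends
-- adjacent to orbit c.
record TwoCycleFactor (G : Graph) : Set where
  field
    σ           : V G → V G
    σ-adj       : ∀ x → Adj G x (σ x)
    σ-injective : ∀ {x y} → σ x ≡ σ y → x ≡ y
    side        : V G → Bool
    base        : Bool → V G
    bound       : ℕ
    to-base     : ∀ x → base (side x) ∈ iterate σ x bound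
    from-base   : ∀ x → x ∈ iterate σ (base (side x)) bound
    hub hub⁻    : Bool → V G
    hub-side    : ∀ c → side (hub c) ≡ not c
    hub⁻-σ      : ∀ c → σ (hub⁻ c) ≡ hub c
    foot foot⁻  : Bool → V G
    foot-side   : ∀ c → side (foot c) ≡ c
    foot⁻-side  : ∀ c → side (foot⁻ c) ≡ c
    foot-adj    : ∀ c → Adj G (foot c) (hub c)
    foot⁻-adj   : ∀ c → Adj G (foot⁻ c) (hub⁻ c)

distinct-elements : ∀ {k} → 2 ≤ k → Σ (Fin k) λ a → Σ (Fin k) λ b → a ≢ b
distinct-elements (s≤s (s≤s _)) = Fin.zero , Fin.suc Fin.zero , λ ()

reach-trans : ∀ {G S x y w} → Reach G S x y → Reach G S y w → Reach G S x w
reach-trans here r = r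
reach-trans (step a y∉S r) r' = step a y∉S (reach-trans r r')

-- Each component K of G - S is
-- charged a vertex of S: if some y ∈ K has σ y ∈ S, the vertex σ y; otherwise
-- K is a whole orbit c (not both orbits, as there are ≥ 2 components), and
-- then hub c ∈ S, since it is adjacent to foot c ∈ K.  The charges are
-- distinct: σ is injective, and if σ y = hub c then y = hub⁻ c lies next to
-- foot⁻ c, in the same component.
module _ {G : Graph} (_≟_ : DecidableEquality (V G)) (F : TwoCycleFactor G) where
  open TwoCycleFactor F
  open Data.List.Membership.DecPropositional _≟_ using (_∈?_)

  module _ (S : List (V G)) where

    Exit : V G → Set
    Exit x = Σ (V G) λ y → Reach G S x y × y ∉ S × σ y ∈ S

    walk : ∀ n x → x ∉ S → Exit x ⊎ All (λ w → w ∉ S × Reach G S x w) (iterate σ x n)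
    walk zero x x∉S = inj₂ []
    walk (suc n) x x∉S with σ x ∈? S
    ... | yes σx∈S = inj₁ (x , here , x∉S , σx∈S)
    ... | no σx∉S with walk n (σ x) σx∉S
    ...   | inj₁ (y , r , y∉S , σy∈S) = inj₁ (y , step (σ-adj x) σx∉S r , y∉S , σy∈S)
    ...   | inj₂ along = inj₂ ((x∉S , here) ∷ All.map (map₂ (step (σ-adj x) σx∉S)) along)

    sweep : ∀ x → x ∉ S → Exit x ⊎ (∀ w → side w ≡ side x → w ∉ S × Reach G S x w)
    sweep x x∉S with walk bound x x∉S
    ... | inj₁ exit = inj₁ exit
    ... | inj₂ along with All.lookup along (to-base x)
    ...   | b∉S , x→b with walk bound (base (side x)) b∉S
    ...     | inj₁ (y , r , y∉S , σy∈S) = inj₁ (y , reach-trans x→b r , y∉S , σy∈S)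
    ...     | inj₂ along' = inj₂ λ w same → map₂ (reach-trans x→b)
                              (All.lookup along' (subst (λ c → w ∈ iterate σ (base c) bound) same (from-base w)))

    module Components {k} (f : Outside G S → Fin k) (onto : ∀ i → Σ (Outside G S) λ x → f x ≡ i)
                      (same : ∀ x y → (f x ≡ f y) ⇔ Reach G S (proj₁ x) (proj₁ y)) (k≥2 : 2 ≤ k) where

      connected : ∀ {x y} (x∉S : x ∉ S) (y∉S : y ∉ S) → Reach G S x y → f (x , x∉S) ≡ f (y , y∉S)
      connected x∉S y∉S = Equivalence.from (same (_ , x∉S) (_ , y∉S))

      not-connected : ∀ x (x∉S : x ∉ S) → ¬ (∀ w (w∉S : w ∉ S) → Reach G S x w)
      not-connected x x∉S reach-all with distinct-elements k≥2
      ... | a , b , a≢b with onto a | onto b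
      ...   | (y , y∉S) , fy | (w , w∉S) , fw =
        a≢b (trans (sym fy) (trans (sym (connected x∉S y∉S (reach-all y y∉S)))
                                   (trans (connected x∉S w∉S (reach-all w w∉S)) fw)))

      data Witness (i : Fin k) : Set where
        exit   : ∀ y (y∉S : y ∉ S) → f (y , y∉S) ≡ i → σ y ∈ S → Witness i
        closed : ∀ c (foot⁻∉S : foot⁻ c ∉ S) → f (foot⁻ c , foot⁻∉S) ≡ i → hub c ∈ S → Witness i

      chosen : ∀ {i} → Witness i → V G
      chosen (exit y _ _ _) = σ y
      chosen (closed c _ _ _) = hub c

      chosen-∈ : ∀ {i} (w : Witness i) → chosen w ∈ S
      chosen-∈ (exit _ _ _ σy∈S) = σy∈S
      chosen-∈ (closed _ _ _ hub∈S) = hub∈S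

      OrbitReached : V G → Set
      OrbitReached x = ∀ w → side w ≡ side x → w ∉ S × Reach G S x w

      reach-hub : ∀ {x} → OrbitReached x → hub (side x) ∉ S → Reach G S x (hub (side x))
      reach-hub orbit hub∉S = reach-trans (proj₂ (orbit _ (foot-side _))) (step (foot-adj _) hub∉S here)

      reach-all : ∀ {x} → OrbitReached x → (hub∉S : hub (side x) ∉ S) → OrbitReached (hub (side x)) →
                  ∀ w → w ∉ S → Reach G S x w
      reach-all {x} orbit hub∉S orbit' w _ with side w Bool.≟ side x
      ... | yes same-side = proj₂ (orbit w same-side)
      ... | no other-side = reach-trans (reach-hub orbit hub∉S)
                              (proj₂ (orbit' w (trans (¬-not other-side) (sym (hub-side _)))))

      -- Every component has a witness: sweep its orbit, then the other one.
      witness : ∀ i → Witness i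
      witness i with onto i
      ... | (x , x∉S) , fx with sweep x x∉S
      ... | inj₁ (y , r , y∉S , σy∈S) = exit y y∉S (trans (sym (connected x∉S y∉S r)) fx) σy∈S
      ... | inj₂ orbit with orbit (foot⁻ (side x)) (foot⁻-side _) | hub (side x) ∈? S
      ...   | foot⁻∉S , x→foot⁻ | yes hub∈S =
        closed (side x) foot⁻∉S (trans (sym (connected x∉S foot⁻∉S x→foot⁻)) fx) hub∈S
      ...   | _ | no hub∉S with sweep (hub (side x)) hub∉S
      ...     | inj₁ (y , r , y∉S , σy∈S) =
        exit y y∉S (trans (sym (connected x∉S y∉S (reach-trans (reach-hub orbit hub∉S) r))) fx) σy∈S
      ...     | inj₂ orbit' = ⊥-elim (not-connected x x∉S (reach-all orbit hub∉S orbit'))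

      -- An exit y with σ y = hub c is hub⁻ c, adjacent to foot⁻ c: same component.
      exit-meets-closed : ∀ {i i' y c} (y∉S : y ∉ S) (foot⁻∉S : foot⁻ c ∉ S) → f (y , y∉S) ≡ i →
                          f (foot⁻ c , foot⁻∉S) ≡ i' → σ y ≡ hub c → i ≡ i'
      exit-meets-closed {c = c} y∉S foot⁻∉S fy ffoot σy≡hub
        with σ-injective (trans σy≡hub (sym (hub⁻-σ c)))
      ... | refl = trans (sym fy) (trans (sym (connected foot⁻∉S y∉S (step (foot⁻-adj c) y∉S here))) ffoot)

      chosen-injective : ∀ {i i'} (w : Witness i) (w' : Witness i') → chosen w ≡ chosen w' → i ≡ i'
      chosen-injective (exit y y∉S fy _) (exit y' y'∉S fy' _) σy≡σy' with σ-injective σy≡σy'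
      ... | refl = trans (sym fy) (trans (connected y∉S y'∉S here) fy')
      chosen-injective (exit _ y∉S fy _) (closed _ foot⁻∉S ffoot _) eq = exit-meets-closed y∉S foot⁻∉S fy ffoot eq
      chosen-injective (closed _ foot⁻∉S ffoot _) (exit _ y∉S fy _) eq =
        sym (exit-meets-closed y∉S foot⁻∉S fy ffoot (sym eq))
      chosen-injective (closed c p fc _) (closed c' p' fc' _) hub≡hub'
        with not-injective (trans (sym (hub-side c)) (trans (cong side hub≡hub') (hub-side c')))
      ... | refl = trans (sym fc) (trans (connected p p' here) fc')

      few-components : k ≤ length S
      few-components = injective⇒≤ {f = λ i → index (chosen-∈ (witness i))}
        λ {i} {i'} same-index → chosen-injective (witness i) (witness i')
          (index-injective (setoid (V G)) (chosen-∈ (witness i)) (chosen-∈ (witness i')) same-index)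

  two-cycle-factor⇒1-tough : OneTough G
  two-cycle-factor⇒1-tough S _ k (f , onto , same) k≥2 = Components.few-components S f onto same k≥2

Vertex : Set
Vertex = Fin 4 × Fin 8

_≟V_ : DecidableEquality Vertex
_≟V_ = ≡-dec Fin._≟_ Fin._≟_

G-adj? : ∀ x y → Dec (Adj (P₄ □ T₁) x y)
G-adj? = □-adj? {P₄} {T₁} Fin._≟_ Fin._≟_ P₄-adj? T₁-adj?

all-vertices? : {P : Vertex → Set} → (∀ x → Dec (P x)) → Dec (∀ x → P x)
all-vertices? P? = map′ (λ h x → h (proj₁ x) (proj₂ x)) (λ h i t → h (i , t)) (all? λ i → all? λ t → P? (i , t))

cycle : Bool → List Vertex
cycle true = (# 0 , # 0) ∷ (# 0 , # 1) ∷ (# 0 , # 5) ∷ (# 1 , # 5) ∷ (# 2 , # 5) ∷ (# 3 , # 5) ∷ (# 3 , # 1) ∷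
             (# 3 , # 0) ∷ (# 2 , # 0) ∷ (# 2 , # 1) ∷ (# 2 , # 2) ∷ (# 3 , # 2) ∷ (# 3 , # 6) ∷ (# 2 , # 6) ∷
             (# 1 , # 6) ∷ (# 0 , # 6) ∷ (# 0 , # 2) ∷ (# 1 , # 2) ∷ (# 1 , # 1) ∷ (# 1 , # 0) ∷ []
cycle false = (# 0 , # 3) ∷ (# 0 , # 4) ∷ (# 1 , # 4) ∷ (# 1 , # 3) ∷ (# 2 , # 3) ∷ (# 2 , # 4) ∷ (# 3 , # 4) ∷
              (# 3 , # 3) ∷ (# 3 , # 7) ∷ (# 2 , # 7) ∷ (# 1 , # 7) ∷ (# 0 , # 7) ∷ []

next-on : List Vertex → Vertex → Vertex
next-on [] x = x
next-on (a ∷ L) x = go (a ∷ L ++ [ a ])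
  where
  go : List Vertex → Vertex
  go (b ∷ c ∷ R) = if ⌊ x ≟V b ⌋ then c else go (c ∷ R)
  go _ = x

side : Vertex → Bool
side x = ⌊ x ∈? cycle true ⌋
  where open Data.List.Membership.DecPropositional _≟V_ using (_∈?_)

σ₁ σ₁⁻¹ : Vertex → Vertex
σ₁ x = next-on (cycle (side x)) x
σ₁⁻¹ x = next-on (reverse (cycle (side x))) x

σ₁⁻¹-σ₁ : ∀ x → σ₁⁻¹ (σ₁ x) ≡ x
σ₁⁻¹-σ₁ = from-yes (all-vertices? λ x → σ₁⁻¹ (σ₁ x) ≟V x)

-- The links: the σ-edge (1 , 3) → (2 , 3) of the second cycle runs beside
-- (1 , 2), (2 , 2) on the first, and the σ-edge (2 , 2) → (3 , 2) of the first
-- beside (2 , 3), (3 , 3) on the second.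
two-cycle-factor : TwoCycleFactor (P₄ □ T₁)
two-cycle-factor = record
  { σ           = σ₁
  ; σ-adj       = from-yes (all-vertices? λ x → G-adj? x (σ₁ x))
  ; σ-injective = λ {x} {y} eq → trans (sym (σ₁⁻¹-σ₁ x)) (trans (cong σ₁⁻¹ eq) (σ₁⁻¹-σ₁ y))
  ; side        = side
  ; base        = base
  ; bound       = 20
  ; to-base     = from-yes (all-vertices? λ x → base (side x) ∈? iterate σ₁ x 20)
  ; from-base   = from-yes (all-vertices? λ x → x ∈? iterate σ₁ (base (side x)) 20)
  ; hub         = hub
  ; hub⁻        = hub⁻
  ; hub-side    = λ { true → refl ; false → refl }
  ; hub⁻-σ      = λ { true → refl ; false → refl }
  ; foot        = foot
  ; foot⁻       = foot⁻
  ; foot-side   = λ { true → refl ; false → refl }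
  ; foot⁻-side  = λ { true → refl ; false → refl }
  ; foot-adj    = λ { true → from-yes (G-adj? (foot true) (hub true))
                    ; false → from-yes (G-adj? (foot false) (hub false)) }
  ; foot⁻-adj   = λ { true → from-yes (G-adj? (foot⁻ true) (hub⁻ true))
                    ; false → from-yes (G-adj? (foot⁻ false) (hub⁻ false)) }
  }
  where
  open Data.List.Membership.DecPropositional _≟V_ using (_∈?_)
  base hub hub⁻ foot foot⁻ : Bool → Vertex
  base true = # 0 , # 0
  base false = # 0 , # 3
  hub true = # 2 , # 3
  hub false = # 3 , # 2
  hub⁻ true = # 1 , # 3
  hub⁻ false = # 2 , # 2
  foot true = # 2 , # 2
  foot false = # 3 , # 3
  foot⁻ true = # 1 , # 2
  foot⁻ false = # 2 , # 3

proposition5p1 : OneTough (P₄ □ T₁) × ¬ Hamiltonian (P₄ □ T₁)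
proposition5p1 = two-cycle-factor⇒1-tough _≟V_ two-cycle-factor , not-Hamiltonian
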